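{- $\chi_{la}(C_4\times P_2)=\chi_{la}((C_4\times P_2)+e)=4$, where $(C_4\times P_2)+e$ is the graph obtained from $C_4\times P_2$ by adding an extra edge $e$ whose end vertices lie in different parts of the bipartition of $C_4\times P_2$.
   Context: $C_4\times P_2$ is the Cartesian product of a 4-cycle and a path on 2 vertices (the cube graph), a bipartite graph. For a simple graph $G=(V,E)$ with $q$ edges, a bijection $f:E\to\{1,\dots,q\}$ is a local antimagic labeling if $f^+(u)\neq f^+(v)$ for every edge $uv$, where $f^+(u)=\sum_{e\ni u} f(e)$. The local antimagic chromatic number $\chi_{la}(G)$ is the minimum number of distinct values of $f^+$ over all local antimagic labelings $f$ of $G$. -}

module Defs where

open import Data.Nat using (ℕ; zero; suc; _+_; _≤_; _%_; _/_)
open import Data.Vec using (Vec; lookup; _∷_; [])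
open import Data.Nat.Properties using () renaming (_≟_ to _≟ℕ_)
open import Data.Fin using (Fin; toℕ; #_) renaming (zero to fz; suc to fs)
open import Data.Fin.Properties using (_≟_)
open import Data.Nat.ListAction using (sum)
open import Data.List using (List; map; length; deduplicate; allFin)
open import Data.Product using (Σ; _×_; _,_; proj₁; proj₂)
open import Data.Bool using (Bool; true; false; if_then_else_; _∨_)
open import Relation.Nullary using (¬_; does)
open import Relation.Binary.PropositionalEquality using (_≡_)
open import Function.Definitions using (Bijective)

-- A graph on n vertices (Fin n) with q edges, given by its edge list:
-- edge e : Fin q has end vertices proj₁ (G e) and proj₂ (G e).
Graph : ℕ → ℕ → Set
Graph n q = Fin q → Fin n × Fin n

Adjacent : ∀ {n q} → Graph n q → Fin n → Fin n → Set
Adjacent {n} {q} G u v =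
  Σ (Fin q) λ e → (proj₁ (G e) ≡ u × proj₂ (G e) ≡ v) Data.Sum.⊎ (proj₁ (G e) ≡ v × proj₂ (G e) ≡ u)
  where import Data.Sum

incident : ∀ {n q} → Graph n q → Fin q → Fin n → Bool
incident G e u = does (proj₁ (G e) ≟ u) ∨ does (proj₂ (G e) ≟ u)

-- An edge labeling f : E → {1,…,q} is encoded as f : Fin q → Fin q,
-- with the label of edge e being 1 + toℕ (f e).
label : ∀ {q} → (Fin q → Fin q) → Fin q → ℕ
label f e = suc (toℕ (f e))

vsum : ∀ {n q} → Graph n q → (Fin q → Fin q) → Fin n → ℕ
vsum {q = q} G f u = sum (map (λ e → if incident G e u then label f e else 0) (allFin q))

IsLocalAntimagic : ∀ {n q} → Graph n q → (Fin q → Fin q) → Set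
IsLocalAntimagic G f =
  Bijective _≡_ _≡_ f × (∀ e → ¬ (vsum G f (proj₁ (G e)) ≡ vsum G f (proj₂ (G e))))

numValues : ∀ {n q} → Graph n q → (Fin q → Fin q) → ℕ
numValues {n} G f = length (deduplicate _≟ℕ_ (map (vsum G f) (allFin n)))

ChiLA≡ : ∀ {n q} → Graph n q → ℕ → Set
ChiLA≡ {q = q} G k =
  (Σ (Fin q → Fin q) λ f → IsLocalAntimagic G f × numValues G f ≡ k) ×
  (∀ (f : Fin q → Fin q) → IsLocalAntimagic G f → k ≤ numValues G f)

-- C₄ × P₂ (the cube graph): vertex (i , j) with i ∈ ℤ₄, j ∈ {0,1}
-- is encoded as i + 4 * j ∈ Fin 8.  12 edges:
-- (i,j)–(i+1 mod 4,j) for j = 0,1, and (i,0)–(i,1).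

cubeEdges : Vec (Fin 8 × Fin 8) 12
cubeEdges =
  (# 0 , # 1) ∷ (# 1 , # 2) ∷ (# 2 , # 3) ∷ (# 3 , # 0) ∷
  (# 4 , # 5) ∷ (# 5 , # 6) ∷ (# 6 , # 7) ∷ (# 7 , # 4) ∷
  (# 0 , # 4) ∷ (# 1 , # 5) ∷ (# 2 , # 6) ∷ (# 3 , # 7) ∷ []

C4×P2 : Graph 8 12
C4×P2 = lookup cubeEdges

-- bipartition class of vertex (i , j): parity of i + j
part : Fin 8 → ℕ
part v = (toℕ v % 4 + toℕ v / 4) % 2

addEdge : ∀ {n q} → Graph n q → Fin n → Fin n → Graph n (suc q)
addEdge G u v fz = (u , v)
addEdge G u v (fs e) = G e

-- Every edge, including an added edge between the two parts, has exactly one end in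
-- each part of the bipartition, so the vertex sums f⁺ of a local antimagic labelling
-- add up on either part to the total label sum S, which is 78 for the cube and 91
-- with the extra edge, in neither case a multiple of 4.  Suppose f⁺ took at most three
-- values.  A part cannot be constant, as its sum would be 4x; up to a rotation of the
-- cube about the axis through vertex 0 we may assume f⁺(0) ≠ f⁺(2).  Their common
-- neighbours 1 and 3 must then share a third value, and following the cube vertex by
-- vertex either makes a part constant or turns the two part sums into a + 3b and
-- a + 3c with b ≠ c.  Explicit labellings with four vertex sums show that the bound is
-- attained; a non-edge between the two parts of the cube always joins antipodal vertices.
module Submission where

open import Defs
open import Data.Bool using (Bool; true; false; not; if_then_else_; _∨_)
import Data.Bool.Properties as Bool
open import Data.Empty using (⊥-elim)
open import Data.Fin using (Fin; toℕ; #_) renaming (zero to fz; suc to fs)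
open import Data.Fin.Properties using (_≟_; all?; any?)
open import Data.List using (List; []; _∷_; map; length; filter; allFin; deduplicate)
import Data.List as List
open import Data.List.Properties using (map-tabulate; map-cong; filter-notAll)
open import Data.List.Membership.Propositional.Properties
  using (∈-filter⁺; ∈-map⁺; ∈-map⁻; ∈-allFin; ∈-deduplicate⁺)
open import Data.List.Relation.Binary.Subset.Propositional using (_⊆_)
open import Data.List.Relation.Unary.All as All using (_∷_; [])
open import Data.List.Relation.Unary.AllPairs using (_∷_; [])
open import Data.List.Relation.Unary.Any as Any using (here; there)
open import Data.List.Relation.Unary.Unique.Propositional using (Unique)
open import Data.Nat using (ℕ; zero; suc; _+_; _*_; _%_; _/_; _≤_; _<_; z≤n; s≤s; _≡ᵇ_)
open import Data.Nat.Divisibility using (_∣_; divides; _∣?_)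
open import Data.Nat.DivMod using (m%n<n)
open import Data.Nat.ListAction using (sum)
open import Data.Nat.Properties
  using (≤-trans; +-identityʳ; *-comm; +-cancelˡ-≡; *-cancelˡ-≡; +-commutativeSemigroup; +-0-commutativeMonoid)
  renaming (_≟_ to _≟ℕ_)
open import Algebra.Properties.CommutativeMonoid.Sum +-0-commutativeMonoid
  using (sum-syntax; sum-cong-≗; ∑-comm; ∑-distrib-+; sum-permute; sum-replicate-zero)
open import Algebra.Properties.CommutativeSemigroup +-commutativeSemigroup using (x∙yz≈y∙xz)
open import Data.Nat.Tactic.RingSolver using (solve-∀)
open import Data.Product using (Σ; _×_; _,_; proj₁; proj₂)
open import Data.Sum using (inj₁; inj₂)
open import Data.Vec using (Vec; lookup; tabulate; _∷_; [])
open import Data.Vec.Properties using (lookup∘tabulate)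
open import Function using (_∘_)
open import Function.Bundles using (mk⤖)
open import Function.Consequences.Propositional using (strictlySurjective⇒surjective; surjective⇒strictlySurjective)
open import Function.Definitions using (Bijective; Injective; Surjective)
open import Function.Properties.Bijection using (⤖⇒↔)
open import Relation.Binary.Definitions using (DecidableEquality)
open import Relation.Binary.PropositionalEquality
  using (_≡_; _≢_; refl; sym; trans; cong; cong₂; subst; _≗_; module ≡-Reasoning)
open import Relation.Nullary using (¬_; Dec; does; yes; no; ¬?; _×-dec_; _⊎-dec_; _→-dec_)
open import Relation.Nullary.Decidable using (map′; from-yes; from-no)

module _ {A : Set} (_≟ᴬ_ : DecidableEquality A) where

  unique-⊆⇒length≤ : ∀ {xs ys : List A} → Unique xs → xs ⊆ ys → length xs ≤ length ys
  unique-⊆⇒length≤ {[]} _ _ = z≤n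
  unique-⊆⇒length≤ {x ∷ xs} {ys} (x∉xs ∷ xs-unique) xs⊆ys =
    ≤-trans (s≤s (unique-⊆⇒length≤ xs-unique xs⊆ys-x))
      (filter-notAll (λ y → ¬? (x ≟ᴬ y)) ys (Any.map (λ x≡y x≢y → x≢y x≡y) (xs⊆ys (here refl))))
    where
    xs⊆ys-x : xs ⊆ filter (λ y → ¬? (x ≟ᴬ y)) ys
    xs⊆ys-x y∈xs = ∈-filter⁺ (λ y → ¬? (x ≟ᴬ y)) (xs⊆ys (there y∈xs)) (All.lookup x∉xs y∈xs)

record FourValues {n : ℕ} (w : Fin n → ℕ) : Set where
  constructor fourValues
  field
    i j k l  : Fin n
    distinct : Unique (map w (i ∷ j ∷ k ∷ l ∷ []))

fourValues-∘ : ∀ {n m} {w : Fin m → ℕ} (σ : Fin n → Fin m) → FourValues (w ∘ σ) → FourValues w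
fourValues-∘ σ (fourValues i j k l distinct) = fourValues (σ i) (σ j) (σ k) (σ l) distinct

fourValues-≗ : ∀ {n} {w w′ : Fin n → ℕ} → w ≗ w′ → FourValues w → FourValues w′
fourValues-≗ w≗w′ (fourValues i j k l distinct) =
  fourValues i j k l (subst Unique (map-cong w≗w′ (i ∷ j ∷ k ∷ l ∷ [])) distinct)

fourValues⇒4≤ : ∀ {n} {w : Fin n → ℕ} → FourValues w →
                4 ≤ length (deduplicate _≟ℕ_ (map w (allFin n)))
fourValues⇒4≤ {w = w} (fourValues i j k l distinct) = unique-⊆⇒length≤ _≟ℕ_ distinct values⊆
  where
  values⊆ : map w (i ∷ j ∷ k ∷ l ∷ []) ⊆ deduplicate _≟ℕ_ (map w (allFin _))
  values⊆ x∈ with v , _ , refl ← ∈-map⁻ w x∈ = ∈-deduplicate⁺ _≟ℕ_ (∈-map⁺ w (∈-allFin v))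

sum-allFin : ∀ {n} (g : Fin n → ℕ) → sum (map g (allFin n)) ≡ ∑[ i < n ] g i
sum-allFin g = trans (cong sum (map-tabulate (λ i → i) g)) (sum-tabulate g)
  where
  sum-tabulate : ∀ {n} (g : Fin n → ℕ) → sum (List.tabulate g) ≡ ∑[ i < n ] g i
  sum-tabulate {zero}  g = refl
  sum-tabulate {suc n} g = cong (g fz +_) (sum-tabulate (g ∘ fs))

∑-label : ∀ {q} {f : Fin q → Fin q} → Bijective _≡_ _≡_ f →
          ∑[ e < q ] label f e ≡ ∑[ i < q ] suc (toℕ i)
∑-label f-bijective = sym (sum-permute (λ i → suc (toℕ i)) (⤖⇒↔ (mk⤖ f-bijective)))

∑-select : ∀ {n} (a : Fin n) (g : Fin n → ℕ) → ∑[ v < n ] (if does (a ≟ v) then g v else 0) ≡ g a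
∑-select {suc n} fz     g = trans (cong (g fz +_) (sum-replicate-zero n)) (+-identityʳ (g fz))
∑-select         (fs a) g = ∑-select a (g ∘ fs)

∑-if : ∀ {m} (b : Bool) (g : Fin m → ℕ) →
       (if b then ∑[ i < m ] g i else 0) ≡ ∑[ i < m ] (if b then g i else 0)
∑-if     true  g = refl
∑-if {m} false g = sym (sum-replicate-zero m)

sideSum : ∀ {n} → (Fin n → Bool) → (Fin n → ℕ) → ℕ
sideSum {n} s w = ∑[ v < n ] (if s v then w v else 0)

sideSum-∑ : ∀ {n m} (s : Fin n → Bool) (F : Fin m → Fin n → ℕ) →
            sideSum s (λ v → ∑[ e < m ] F e v) ≡ ∑[ e < m ] sideSum s (F e)
sideSum-∑ s F =
  trans (sum-cong-≗ λ v → ∑-if (s v) (λ e → F e v)) (∑-comm (λ v e → if s v then F e v else 0))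

module _ {n} (s : Fin n → Bool) {a b : Fin n} (sa≢sb : s a ≢ s b) (c : ℕ) where

  private
    onSide : Fin n → ℕ
    onSide v = if s v then c else 0

    at : Fin n → Fin n → ℕ
    at x v = if does (x ≟ v) then onSide v else 0

  sideSum-edge : sideSum s (λ v → if does (a ≟ v) ∨ does (b ≟ v) then c else 0) ≡ c
  sideSum-edge = begin
    sideSum s (λ v → if does (a ≟ v) ∨ does (b ≟ v) then c else 0)
      ≡⟨ sum-cong-≗ split ⟩
    ∑[ v < n ] (at a v + at b v)
      ≡⟨ ∑-distrib-+ (at a) (at b) ⟩
    ∑[ v < n ] at a v + ∑[ v < n ] at b v
      ≡⟨ cong₂ _+_ (∑-select a onSide) (∑-select b onSide) ⟩
    onSide a + onSide b
      ≡⟨ exactly-one (s a) (s b) sa≢sb ⟩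
    c ∎
    where
    open ≡-Reasoning
    split : ∀ v → (if s v then (if does (a ≟ v) ∨ does (b ≟ v) then c else 0) else 0) ≡ at a v + at b v
    split v with a ≟ v | b ≟ v | s v
    ... | yes refl | yes refl | _     = ⊥-elim (sa≢sb refl)
    ... | yes _    | no _     | true  = sym (+-identityʳ c)
    ... | yes _    | no _     | false = refl
    ... | no _     | yes _    | _     = refl
    ... | no _     | no _     | true  = refl
    ... | no _     | no _     | false = refl
    exactly-one : ∀ x y → x ≢ y → (if x then c else 0) + (if y then c else 0) ≡ c
    exactly-one true  true  x≢y = ⊥-elim (x≢y refl)
    exactly-one true  false _   = +-identityʳ c
    exactly-one false true  _   = refl
    exactly-one false false x≢y = ⊥-elim (x≢y refl)

IsBipartition : ∀ {n q} → (Fin n → Bool) → Graph n q → Set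
IsBipartition s G = ∀ e → s (proj₁ (G e)) ≢ s (proj₂ (G e))

addEdge-bipartition : ∀ {n q} {G : Graph n q} {s : Fin n → Bool} {u v} →
                      IsBipartition s G → s u ≢ s v → IsBipartition s (addEdge G u v)
addEdge-bipartition bipartite su≢sv fz     = su≢sv
addEdge-bipartition bipartite su≢sv (fs e) = bipartite e

handshake : ∀ {n q} (G : Graph n q) {s : Fin n → Bool} → IsBipartition s G →
            ∀ f → sideSum s (vsum G f) ≡ ∑[ e < q ] label f e
handshake {q = q} G {s} bipartite f = begin
  sideSum s (vsum G f)
    ≡⟨ sum-cong-≗ (λ v → cong (λ t → if s v then t else 0) (sum-allFin (labelAt v))) ⟩
  sideSum s (λ v → ∑[ e < q ] labelAt v e)
    ≡⟨ sideSum-∑ s (λ e v → labelAt v e) ⟩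
  ∑[ e < q ] sideSum s (λ v → labelAt v e)
    ≡⟨ sum-cong-≗ (λ e → sideSum-edge s (bipartite e) (label f e)) ⟩
  ∑[ e < q ] label f e ∎
  where
  open ≡-Reasoning
  labelAt : Fin _ → Fin q → ℕ
  labelAt v e = if incident G e v then label f e else 0

IsProperColouring : ∀ {n q} → Graph n q → (Fin n → ℕ) → Set
IsProperColouring G w = ∀ e → w (proj₁ (G e)) ≢ w (proj₂ (G e))

adjacent⇒≢ : ∀ {n q} {G : Graph n q} {w} → IsProperColouring G w →
             ∀ {u v} → Adjacent G u v → w u ≢ w v
adjacent⇒≢ proper (e , inj₁ (refl , refl)) = proper e
adjacent⇒≢ proper (e , inj₂ (refl , refl)) = proper e ∘ sym

properColouring-∘ : ∀ {n m p q} (G : Graph n p) (H : Graph m q) {w} (σ : Fin n → Fin m) →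
                    (∀ e → Adjacent H (σ (proj₁ (G e))) (σ (proj₂ (G e)))) →
                    IsProperColouring H w → IsProperColouring G (w ∘ σ)
properColouring-∘ G H {w} σ σ-adjacent proper e = adjacent⇒≢ {w = w} proper (σ-adjacent e)

properColouring-≗ : ∀ {n q} {G : Graph n q} {w w′} → w ≗ w′ →
                    IsProperColouring G w → IsProperColouring G w′
properColouring-≗ w≗w′ proper e w′u≡w′v =
  proper e (trans (w≗w′ _) (trans w′u≡w′v (sym (w≗w′ _))))

adjacent? : ∀ {n q} (G : Graph n q) u v → Dec (Adjacent G u v)
adjacent? G u v = any? λ e →
  (proj₁ (G e) ≟ u ×-dec proj₂ (G e) ≟ v) ⊎-dec (proj₁ (G e) ≟ v ×-dec proj₂ (G e) ≟ u)

injective? : ∀ {m n} (f : Fin m → Fin n) → Dec (Injective _≡_ _≡_ f)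
injective? f = map′ (λ inj {x} {y} → inj x y) (λ inj x y → inj)
  (all? λ x → all? λ y → (f x ≟ f y) →-dec (x ≟ y))

surjective? : ∀ {m n} (f : Fin m → Fin n) → Dec (Surjective _≡_ _≡_ f)
surjective? f = map′ strictlySurjective⇒surjective (surjective⇒strictlySurjective {f = f})
  (all? λ y → any? λ x → f x ≟ y)

isLocalAntimagic? : ∀ {n q} (G : Graph n q) f → Dec (IsLocalAntimagic G f)
isLocalAntimagic? G f = (injective? f ×-dec surjective? f) ×-dec
  all? λ e → ¬? (vsum G f (proj₁ (G e)) ≟ℕ vsum G f (proj₂ (G e)))

HasLocalAntimagicLabelling : ∀ {n q} → Graph n q → ℕ → Set
HasLocalAntimagicLabelling {q = q} G k = Σ (Fin q → Fin q) λ f → IsLocalAntimagic G f × numValues G f ≡ k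

4∣sum-of-equals : ∀ {a b c d} → a ≡ b → a ≡ c → a ≡ d → 4 ∣ a + (b + (c + (d + 0)))
4∣sum-of-equals {a} refl refl refl = divides a (*-comm 4 a)

m+3n≡m+3o⇒n≡o : ∀ m {n o} → m + 3 * n ≡ m + 3 * o → n ≡ o
m+3n≡m+3o⇒n≡o m {n} {o} eq = *-cancelˡ-≡ n o 3 (+-cancelˡ-≡ m _ _ eq)

x+3z≡y+y+y+x⇒z≡y : ∀ {x y z} → x + 3 * z ≡ y + (y + (y + (x + 0))) → z ≡ y
x+3z≡y+y+y+x⇒z≡y {x} {y} eq = m+3n≡m+3o⇒n≡o x (trans eq (rearrange x y))
  where
  rearrange : ∀ x y → y + (y + (y + (x + 0))) ≡ x + 3 * y
  rearrange = solve-∀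

x+z+x+x≡y+y+z+y⇒x≡y : ∀ {x y z} → x + (z + (x + (x + 0))) ≡ y + (y + (z + (y + 0))) → x ≡ y
x+z+x+x≡y+y+z+y⇒x≡y {x} {y} {z} eq =
  m+3n≡m+3o⇒n≡o z (trans (sym (rearrangeˡ x z)) (trans eq (rearrangeʳ y z)))
  where
  rearrangeˡ : ∀ x z → x + (z + (x + (x + 0))) ≡ z + 3 * x
  rearrangeˡ = solve-∀
  rearrangeʳ : ∀ y z → y + (y + (z + (y + 0))) ≡ z + 3 * y
  rearrangeʳ = solve-∀

side : Fin 8 → Bool
side v = part v ≡ᵇ 0

side-≢ : ∀ {u v} → part u ≢ part v → side u ≢ side v
side-≢ {u} {v} pu≢pv =
  pu≢pv ∘ bits-≡ (m%n<n (toℕ u % 4 + toℕ u / 4) 2) (m%n<n (toℕ v % 4 + toℕ v / 4) 2)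
  where
  bits-≡ : ∀ {x y} → x < 2 → y < 2 → (x ≡ᵇ 0) ≡ (y ≡ᵇ 0) → x ≡ y
  bits-≡ {0} {0} _ _ _ = refl
  bits-≡ {1} {1} _ _ _ = refl
  bits-≡ {0} {1} _ _ ()
  bits-≡ {1} {0} _ _ ()
  bits-≡ {suc (suc _)} (s≤s (s≤s ())) _ _
  bits-≡ {_} {suc (suc _)} _ (s≤s (s≤s ())) _

side-bipartition : IsBipartition side C4×P2
side-bipartition = from-yes (all? λ e → ¬? (side (proj₁ (C4×P2 e)) Bool.≟ side (proj₂ (C4×P2 e))))

Balanced : ℕ → (Fin 8 → ℕ) → Set
Balanced S w = sideSum side w ≡ S × sideSum (not ∘ side) w ≡ S

-- Rotation of the cube about the axis through vertices 0 and 6; it cycles 2 ↦ 7 ↦ 5.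
rotate : Fin 8 → Fin 8
rotate = lookup (# 0 ∷ # 3 ∷ # 7 ∷ # 4 ∷ # 1 ∷ # 2 ∷ # 6 ∷ # 5 ∷ [])

rotate-adjacent : ∀ e → Adjacent C4×P2 (rotate (proj₁ (C4×P2 e))) (rotate (proj₂ (C4×P2 e)))
rotate-adjacent = from-yes (all? λ e → adjacent? C4×P2 (rotate (proj₁ (C4×P2 e))) (rotate (proj₂ (C4×P2 e))))

properColouring-rotate : ∀ w → IsProperColouring C4×P2 w → IsProperColouring C4×P2 (w ∘ rotate)
properColouring-rotate w = properColouring-∘ C4×P2 C4×P2 {w} rotate rotate-adjacent

balanced-rotate : ∀ {S} w → Balanced S w → Balanced S (w ∘ rotate)
balanced-rotate w (sumA , sumB) =
  trans (cong (w (# 0) +_) (cycle (w (# 7)) (w (# 2)) (w (# 5)) 0)) sumA ,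
  trans (sym (cycle (w (# 1)) (w (# 3)) (w (# 4)) (w (# 6) + 0))) sumB
  where
  cycle : ∀ x y z r → x + (y + (z + r)) ≡ y + (z + (x + r))
  cycle x y z r = trans (x∙yz≈y∙xz x y (z + r)) (cong (y +_) (x∙yz≈y∙xz x z r))

newValue⇒fourValues : ∀ {w : Fin 8 → ℕ} → IsProperColouring C4×P2 w → w (# 0) ≢ w (# 2) →
                      ∀ k → w k ≢ w (# 0) → w k ≢ w (# 2) → w k ≢ w (# 1) → FourValues w
newValue⇒fourValues proper w0≢w2 k k≢0 k≢2 k≢1 = fourValues (# 0) (# 2) (# 1) k
  ( (w0≢w2 ∷ proper (# 0) ∷ k≢0 ∘ sym ∷ [])
  ∷ (proper (# 1) ∘ sym ∷ k≢2 ∘ sym ∷ [])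
  ∷ (k≢1 ∘ sym ∷ [])
  ∷ [] ∷ [])

module _ {S : ℕ} (4∤S : ¬ 4 ∣ S) where

  fourValues-0≢2 : ∀ w → IsProperColouring C4×P2 w → Balanced S w → w (# 0) ≢ w (# 2) → FourValues w
  fourValues-0≢2 w proper balanced w0≢w2 = fourValues-≗ (lookup∘tabulate w)
    (go (tabulate w) (properColouring-≗ (sym ∘ lookup∘tabulate w) proper) balanced w0≢w2)
    where
    -- On a vector of variables every successful test a ≟ b can be matched as refl,
    -- which substitutes it into the part sums.  Throughout, x = a0, z = a2, y = a1.
    go : ∀ (v : Vec ℕ 8) → IsProperColouring C4×P2 (lookup v) → Balanced S (lookup v) →
         lookup v (# 0) ≢ lookup v (# 2) → FourValues (lookup v)
    go v@(a0 ∷ a1 ∷ a2 ∷ a3 ∷ a4 ∷ a5 ∷ a6 ∷ a7 ∷ []) proper (sumA , sumB) a0≢a2 with a3 ≟ℕ a1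
    ... | no a3≢a1 = newValue⇒fourValues proper a0≢a2 (# 3) (proper (# 3)) (proper (# 2) ∘ sym) a3≢a1
    ... | yes refl with a4 ≟ℕ a1
    ...   | yes refl with a6 ≟ℕ a1
    ...     | yes refl = ⊥-elim (4∤S (subst (4 ∣_) sumB (4∣sum-of-equals {lookup v (# 1)} refl refl refl)))
    ...     | no a6≢a1 with a6 ≟ℕ a0
    ...       | no a6≢a0 = newValue⇒fourValues proper a0≢a2 (# 6) a6≢a0 (proper (# 10) ∘ sym) a6≢a1
    ...       | yes refl with a5 ≟ℕ a2
    ...         | no a5≢a2 = newValue⇒fourValues proper a0≢a2 (# 5) (proper (# 5)) a5≢a2 (proper (# 9) ∘ sym)
    ...         | yes refl with a7 ≟ℕ a2
    ...           | no a7≢a2 = newValue⇒fourValues proper a0≢a2 (# 7) (proper (# 6) ∘ sym) a7≢a2 (proper (# 11) ∘ sym)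
    ...           | yes refl = ⊥-elim (proper (# 1) (sym (x+3z≡y+y+y+x⇒z≡y
                                 {lookup v (# 0)} {lookup v (# 1)} {lookup v (# 2)} (trans sumA (sym sumB)))))
    go v@(a0 ∷ a1 ∷ a2 ∷ a3 ∷ a4 ∷ a5 ∷ a6 ∷ a7 ∷ []) proper (sumA , sumB) a0≢a2 | yes refl | no a4≢a1
      with a4 ≟ℕ a2
    ... | no a4≢a2 = newValue⇒fourValues proper a0≢a2 (# 4) (proper (# 8) ∘ sym) a4≢a2 a4≢a1
    ... | yes refl with a5 ≟ℕ a0
    ...   | no a5≢a0 = newValue⇒fourValues proper a0≢a2 (# 5) a5≢a0 (proper (# 4) ∘ sym) (proper (# 9) ∘ sym)
    ...   | yes refl with a7 ≟ℕ a0
    ...     | no a7≢a0 = newValue⇒fourValues proper a0≢a2 (# 7) a7≢a0 (proper (# 7)) (proper (# 11) ∘ sym)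
    ...     | yes refl with a6 ≟ℕ a1
    ...       | no a6≢a1 = newValue⇒fourValues proper a0≢a2 (# 6) (proper (# 5) ∘ sym) (proper (# 10) ∘ sym) a6≢a1
    ...       | yes refl = ⊥-elim (proper (# 0) (x+z+x+x≡y+y+z+y⇒x≡y
                             {lookup v (# 0)} {lookup v (# 1)} {lookup v (# 2)} (trans sumA (sym sumB))))

  cube-fourValues : ∀ w → IsProperColouring C4×P2 w → Balanced S w → FourValues w
  cube-fourValues w proper balanced with w (# 0) ≟ℕ w (# 2) | w (# 0) ≟ℕ w (# 7) | w (# 0) ≟ℕ w (# 5)
  ... | no w0≢w2 | _ | _ = fourValues-0≢2 w proper balanced w0≢w2
  ... | yes _ | no w0≢w7 | _ = fourValues-∘ rotate
    (fourValues-0≢2 (w ∘ rotate) (properColouring-rotate w proper) (balanced-rotate w balanced) w0≢w7)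
  ... | yes _ | yes _ | no w0≢w5 = fourValues-∘ rotate (fourValues-∘ rotate
    (fourValues-0≢2 (w ∘ rotate ∘ rotate)
      (properColouring-rotate (w ∘ rotate) (properColouring-rotate w proper))
      (balanced-rotate (w ∘ rotate) (balanced-rotate w balanced)) w0≢w5))
  ... | yes w0≡w2 | yes w0≡w7 | yes w0≡w5 =
    ⊥-elim (4∤S (subst (4 ∣_) (proj₁ balanced) (4∣sum-of-equals w0≡w2 w0≡w5 w0≡w7)))

χla≥4 : ∀ {q} (H : Graph 8 q) → IsBipartition side H →
        (∀ e → Adjacent H (proj₁ (C4×P2 e)) (proj₂ (C4×P2 e))) →
        ¬ 4 ∣ ∑[ i < q ] suc (toℕ i) → ∀ f → IsLocalAntimagic H f → 4 ≤ numValues H f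
χla≥4 H bipartite cube⊆H 4∤S f (f-bijective , antimagic) =
  fourValues⇒4≤ (cube-fourValues 4∤S (vsum H f)
    (properColouring-∘ C4×P2 H {vsum H f} (λ v → v) cube⊆H antimagic)
    ( trans (handshake H {side} bipartite f) (∑-label f-bijective)
    , trans (handshake H {not ∘ side} (λ e → bipartite e ∘ Bool.not-injective) f) (∑-label f-bijective)))

cube-labelling : HasLocalAntimagicLabelling C4×P2 4
cube-labelling = labelling , from-yes (isLocalAntimagic? C4×P2 labelling ×-dec numValues C4×P2 labelling ≟ℕ 4)
  where
  labelling : Fin 12 → Fin 12
  labelling = lookup (# 7 ∷ # 8 ∷ # 4 ∷ # 6 ∷ # 9 ∷ # 1 ∷ # 3 ∷ # 2 ∷ # 10 ∷ # 0 ∷ # 11 ∷ # 5 ∷ [])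

antipode : Fin 8 → Fin 8
antipode = lookup (# 6 ∷ # 7 ∷ # 4 ∷ # 5 ∷ # 2 ∷ # 3 ∷ # 0 ∷ # 1 ∷ [])

nonadjacent⇒antipode : ∀ u v → part u ≢ part v → ¬ Adjacent C4×P2 u v → v ≡ antipode u
nonadjacent⇒antipode = from-yes (all? λ u → all? λ v →
  ¬? (part u ≟ℕ part v) →-dec ¬? (adjacent? C4×P2 u v) →-dec v ≟ antipode u)

antipodalEdge-labelling : ∀ u → HasLocalAntimagicLabelling (addEdge C4×P2 u (antipode u)) 4
antipodalEdge-labelling u = labelling u , valid u
  where
  l06 l17 l24 l35 : Vec (Fin 13) 13
  l06 = # 4 ∷ # 9 ∷ # 7 ∷ # 0 ∷ # 2 ∷ # 10 ∷ # 1 ∷ # 6 ∷ # 11 ∷ # 3 ∷ # 8 ∷ # 12 ∷ # 5 ∷ []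
  l17 = # 12 ∷ # 3 ∷ # 4 ∷ # 1 ∷ # 11 ∷ # 7 ∷ # 5 ∷ # 9 ∷ # 6 ∷ # 0 ∷ # 2 ∷ # 8 ∷ # 10 ∷ []
  l24 = # 4 ∷ # 12 ∷ # 5 ∷ # 1 ∷ # 7 ∷ # 10 ∷ # 3 ∷ # 9 ∷ # 8 ∷ # 0 ∷ # 6 ∷ # 11 ∷ # 2 ∷ []
  l35 = # 9 ∷ # 3 ∷ # 6 ∷ # 10 ∷ # 0 ∷ # 5 ∷ # 2 ∷ # 11 ∷ # 12 ∷ # 4 ∷ # 7 ∷ # 8 ∷ # 1 ∷ []
  labelling : Fin 8 → Fin 13 → Fin 13
  labelling u = lookup (lookup (l06 ∷ l17 ∷ l24 ∷ l35 ∷ l24 ∷ l35 ∷ l06 ∷ l17 ∷ []) u)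
  valid : ∀ u → let G = addEdge C4×P2 u (antipode u) in
          IsLocalAntimagic G (labelling u) × numValues G (labelling u) ≡ 4
  valid = from-yes (all? λ u → let G = addEdge C4×P2 u (antipode u) in
    isLocalAntimagic? G (labelling u) ×-dec numValues G (labelling u) ≟ℕ 4)

theorem2p3 : ChiLA≡ C4×P2 4 ×
    (∀ u v → part u ≢ part v → ¬ Adjacent C4×P2 u v → ChiLA≡ (addEdge C4×P2 u v) 4)
theorem2p3 =
  (cube-labelling , χla≥4 C4×P2 side-bipartition (λ e → e , inj₁ (refl , refl)) (from-no (4 ∣? 78))) ,
  λ u v pu≢pv nonadjacent →
    subst (λ v → HasLocalAntimagicLabelling (addEdge C4×P2 u v) 4)
      (sym (nonadjacent⇒antipode u v pu≢pv nonadjacent)) (antipodalEdge-labelling u) ,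
    χla≥4 (addEdge C4×P2 u v)
      (addEdge-bipartition {G = C4×P2} {s = side} {u} {v} side-bipartition (side-≢ {u} {v} pu≢pv))
      (λ e → fs e , inj₁ (refl , refl)) (from-no (4 ∣? 91))
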